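{- Let $n\in\mathbb{N}$ and let $w\in\mathcal{C}_{n,0}$ be ascending, i.e. $w(1)<w(2)<\dots<w(n)$. Let $j\in[\lfloor n/2\rfloor]$. Then $i(2j)-i(2j-1)$ is odd, where $i(k):=|w(k)|$. Furthermore: (1) if $w(2j)>0$, then $i(2j)-i(2j-1)>0$ and $w^{ -1}(e)<0$ for all $e\in\mathbb{N}$ with $i(2j-1)<e<i(2j)$; moreover $w(2j-1)>0$ unless possibly $i(2j-1)=1$; (2) if $w(2j)<0$, then $i(2j-1)-i(2j)=1$.
   Context: For $n\in\mathbb{N}$ let $[n]=\{1,\dots,n\}$ and $[\pm n]_0=\{ -n,\dots,n\}$. $B_n$ is the group of permutations $w$ of $[\pm n]_0$ with $w(-j)=-w(j)$. The set of even chessboard elements is $\mathcal{C}_{n,0}=\{w\in B_n: |w(j)|\equiv j\pmod 2\text{ for all }j\in[n]\}$. -}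

module Defs where

open import Data.Nat as ℕ using (ℕ; suc)
open import Data.Nat.DivMod using (_%_)
open import Data.Integer as ℤ using (ℤ; +_; -_; ∣_∣; _≤_; _<_; _+_; _*_)
open import Data.Product using (Σ; _×_; ∃)
open import Relation.Binary.PropositionalEquality using (_≡_)

InRange : ℕ → ℤ → Set
InRange n k = (- (+ n)) ≤ k × k ≤ + n

-- A signed permutation w ∈ B_n, represented as a function ℤ → ℤ whose
-- restriction to [±n]_0 is a permutation of [±n]_0 with w(-k) = -w(k).
-- (Values outside [±n]_0 are irrelevant.)
record InB (n : ℕ) (w : ℤ → ℤ) : Set where
  field
    maps-into  : ∀ k → InRange n k → InRange n (w k)
    injective  : ∀ k l → InRange n k → InRange n l → w k ≡ w l → k ≡ l
    surjective : ∀ m → InRange n m → Σ ℤ (λ k → InRange n k × w k ≡ m)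
    odd-sym    : ∀ k → InRange n k → w (- k) ≡ - (w k)

EvenChessboard : ℕ → (ℤ → ℤ) → Set
EvenChessboard n w = ∀ (j : ℕ) → 1 ℕ.≤ j → j ℕ.≤ n → ∣ w (+ j) ∣ % 2 ≡ j % 2

InC0 : ℕ → (ℤ → ℤ) → Set
InC0 n w = InB n w × EvenChessboard n w

Ascending : ℕ → (ℤ → ℤ) → Set
Ascending n w = ∀ (k : ℕ) → 1 ℕ.≤ k → k ℕ.< n → w (+ k) < w (+ suc k)

OddZ : ℤ → Set
OddZ d = ∃ λ m → d ≡ + 1 + + 2 * m

module Submission where

-- Write f(k) = |w(k)|.  Because w ∈ B_n, f is a permutation of
-- [n]; because w is ascending, the negative values of w come first and the
-- positive ones last, so f decreases and then increases ("valley shape").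
--
-- The key general fact is about valley-shaped permutations f of [n]: for
-- every v the positions carrying the values 1,…,v form a block of v
-- consecutive positions, and the position of v+1 sits immediately to the
-- left or to the right of that block.
--
-- For the pair of positions p = 2j-1 (odd) and p+1 = 2j (even) the
-- chessboard condition says f(p) is odd and f(p+1) is even, whence the
-- difference is odd.  If w(p+1) > 0: either w(p) > 0 and ascent gives
-- f(p) < f(p+1), or w(p) < 0 < w(p+1) is the sign change, which is where
-- the value 1 sits, and by parity it must sit at p; values strictly between
-- f(p) and f(p+1) cannot be attained at nonnegative arguments since no
-- position fits between p and p+1.  If w(p+1) < 0 with c = f(p+1) < f(p),
-- the block of the values 1,…,c starts at p+1, so the value c+1 sits at p or
-- at p+1+c; the latter is excluded by parity, hence f(p) = c+1.

open import Defs
open import Data.Nat as ℕ using (ℕ; _/_; zero; suc; z≤n; s≤s)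
open import Data.Nat.Properties as ℕP
  using ( ≤-refl; ≤-trans; <-trans; ≤-<-trans; <-≤-trans; <⇒≤; ≤-pred; <⇒≱; ≮⇒≥; ≤-antisym
        ; ≤-reflexive; n<1+n; n≤1+n; m≤n⇒m≤1+n; m≤n⇒m<n∨m≡n; m<1+n⇒m<n∨m≡n
        ; m<m+n; m≤m+n; +-monoʳ-<; +-suc; +-identityʳ; <-irrefl
        ; <-cmp; _<?_ )
open import Data.Nat.DivMod
  using (_%_; %-distribˡ-+; %-pred-≡0; m*n%n≡0; m≡m%n+[m/n]*n; m/n*n≤m)
open import Data.Integer as ℤ using (ℤ; +_; -[1+_]; ∣_∣; _<_; _-_; +<+; -<+; -<-; +≤+; -≤+; -≤-)
import Data.Integer.Properties as ℤP
open import Data.Integer.Tactic.RingSolver using (solve-∀)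
open import Data.Product using (_×_; _,_; Σ; proj₁; proj₂)
open import Data.Sum using (_⊎_; inj₁; inj₂)
import Data.Sum
open import Data.Empty using (⊥; ⊥-elim)
open import Relation.Binary using (tri<; tri≈; tri>)
open import Relation.Binary.PropositionalEquality
open import Relation.Nullary using (yes; no)

neg≤pos : ∀ m k → ℤ.- (+ m) ℤ.≤ + k
neg≤pos zero    k = +≤+ z≤n
neg≤pos (suc m) k = -≤+

neg-in-range : ∀ {m k} → suc k ℕ.≤ m → InRange m -[1+ k ]
neg-in-range (s≤s k≤m) = -≤- k≤m , -≤+

abs-in-range : ∀ {m} x → InRange m x → ∣ x ∣ ℕ.≤ m
abs-in-range (+ k)     (_ , +≤+ k≤m) = k≤m
abs-in-range {suc m} -[1+ k ] (-≤- k≤m , _) = s≤s k≤m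

abs-cancel : ∀ x y → ∣ x ∣ ≡ ∣ y ∣ → x ≡ y ⊎ x ≡ ℤ.- y
abs-cancel (+ a)    (+ b)       refl = inj₁ refl
abs-cancel (+ a)    -[1+ b ]    refl = inj₂ refl
abs-cancel -[1+ a ] (+ suc b)   refl = inj₂ refl
abs-cancel -[1+ a ] -[1+ b ]    refl = inj₁ refl

abs-antitone-neg : ∀ {x y} → x < y → y < + 0 → ∣ y ∣ ℕ.< ∣ x ∣
abs-antitone-neg (-<- p) _         = s≤s p
abs-antitone-neg _       (+<+ ())

abs-monotone-pos : ∀ {x y} → + 0 < x → x < y → ∣ x ∣ ℕ.< ∣ y ∣
abs-monotone-pos _ (+<+ p) = p

below-of-abs : ∀ {e} x → ∣ x ∣ ℕ.< e → x < + e
below-of-abs (+ a)    h = +<+ h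
below-of-abs -[1+ a ] h = -<+

above-of-abs : ∀ {e x} → + 0 < x → e ℕ.< ∣ x ∣ → + e < x
above-of-abs (+<+ _) h = +<+ h

sign-of-nonzero : ∀ x → 1 ℕ.≤ ∣ x ∣ → x < + 0 ⊎ + 0 < x
sign-of-nonzero (+ suc a) _ = inj₂ (+<+ (s≤s z≤n))
sign-of-nonzero -[1+ a ]  _ = inj₁ -<+

self-negative : ∀ x → x ≡ ℤ.- x → x ≡ + 0
self-negative (+ zero) _ = refl

even-minus-odd : ∀ x y → x % 2 ≡ 0 → y % 2 ≡ 1 → OddZ (+ x - + y)
even-minus-odd x y x-even y-odd = + (x / 2) - + (y / 2) - + 1 , eq
  where
  x≡ : x ≡ (x / 2) ℕ.* 2
  x≡ = trans (m≡m%n+[m/n]*n x 2) (cong (ℕ._+ (x / 2) ℕ.* 2) x-even)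
  y≡ : y ≡ 1 ℕ.+ (y / 2) ℕ.* 2
  y≡ = trans (m≡m%n+[m/n]*n y 2) (cong (ℕ._+ (y / 2) ℕ.* 2) y-odd)
  normalise : ∀ X Y → X ℤ.* + 2 - (+ 1 ℤ.+ Y ℤ.* + 2) ≡ + 1 ℤ.+ + 2 ℤ.* (X - Y - + 1)
  normalise = solve-∀
  eq : + x - + y ≡ + 1 ℤ.+ + 2 ℤ.* (+ (x / 2) - + (y / 2) - + 1)
  eq = begin
    + x - + y
      ≡⟨ cong₂ (λ a b → + a - + b) x≡ y≡ ⟩
    + ((x / 2) ℕ.* 2) - + (1 ℕ.+ (y / 2) ℕ.* 2)
      ≡⟨ cong₂ _-_ (ℤP.pos-* (x / 2) 2)
                   (trans (ℤP.pos-+ 1 ((y / 2) ℕ.* 2)) (cong (ℤ._+_ (+ 1)) (ℤP.pos-* (y / 2) 2))) ⟩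
    + (x / 2) ℤ.* + 2 - (+ 1 ℤ.+ + (y / 2) ℤ.* + 2)
      ≡⟨ normalise (+ (x / 2)) (+ (y / 2)) ⟩
    + 1 ℤ.+ + 2 ℤ.* (+ (x / 2) - + (y / 2) - + 1) ∎
    where open ≡-Reasoning

positive-difference : ∀ {x y} → y ℕ.< x → + 0 < + x - + y
positive-difference {x} {y} y<x rewrite ℤP.m-n≡m⊖n x y | ℤP.⊖-≥ (<⇒≤ y<x) =
  +<+ (ℕP.m<n⇒0<n∸m y<x)

successor-difference : ∀ c → + suc c - + c ≡ + 1
successor-difference c = trans (cong (_- + c) (ℤP.pos-+ 1 c)) (cancel (+ c))
  where
  cancel : ∀ C → (+ 1 ℤ.+ C) - C ≡ + 1
  cancel = solve-∀

even+even : ∀ m k → m % 2 ≡ 0 → k % 2 ≡ 0 → (m ℕ.+ k) % 2 ≡ 0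
even+even m k m-even k-even =
  trans (%-distribˡ-+ m k 2) (cong₂ (λ a b → (a ℕ.+ b) % 2) m-even k-even)

odd⇒positive : ∀ p → p % 2 ≡ 1 → 1 ℕ.≤ p
odd⇒positive (suc p) _ = s≤s z≤n

suc-even : ∀ m → m % 2 ≡ 0 → suc m % 2 ≡ 1
suc-even m m-even = trans (%-distribˡ-+ 1 m 2) (cong (λ a → (1 ℕ.+ a) % 2) m-even)

-- Valley-shaped permutations of [n] and the blocks of their small values.

Pos : ℕ → ℕ → Set
Pos n k = 1 ℕ.≤ k × k ℕ.≤ n

record Valley (n : ℕ) (f : ℕ → ℕ) : Set where
  field
    positive   : ∀ {k} → Pos n k → 1 ℕ.≤ f k
    bounded    : ∀ {k} → Pos n k → f k ℕ.≤ n
    injective  : ∀ {k l} → Pos n k → Pos n l → f k ≡ f l → k ≡ l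
    surjective : ∀ {v} → Pos n v → Σ ℕ λ k → Pos n k × f k ≡ v
    dip        : ∀ {q k r} → Pos n q → Pos n r → q ℕ.< k → k ℕ.< r →
                 f k ℕ.< f q ⊎ f k ℕ.< f r

InBlock : ℕ → ℕ → ℕ → Set
InBlock L v k = L ℕ.≤ k × k ℕ.< L ℕ.+ v

not-in-empty : ∀ {L k} → InBlock L 0 k → ⊥
not-in-empty {L} (L≤k , k<L+0) = <⇒≱ k<L+0 (subst (ℕ._≤ _) (sym (+-identityʳ L)) L≤k)

extend-left : ∀ {q v k} → InBlock q (suc v) k → InBlock (suc q) v k ⊎ k ≡ q
extend-left {q} {v} {k} (q≤k , k<end) with m≤n⇒m<n∨m≡n q≤k
... | inj₁ q<k = inj₁ (q<k , subst (k ℕ.<_) (+-suc q v) k<end)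
... | inj₂ refl = inj₂ refl

extend-left⁻¹ : ∀ {q v k} → InBlock (suc q) v k ⊎ k ≡ q → InBlock q (suc v) k
extend-left⁻¹ {q} {v} {k} (inj₁ (q<k , k<end)) = <⇒≤ q<k , subst (k ℕ.<_) (sym (+-suc q v)) k<end
extend-left⁻¹ {q} {v} (inj₂ refl) = ≤-refl , m<m+n q (s≤s z≤n)

extend-right : ∀ {L v k} → InBlock L (suc v) k → InBlock L v k ⊎ k ≡ L ℕ.+ v
extend-right {L} {v} {k} (L≤k , k<end) with m<1+n⇒m<n∨m≡n (subst (k ℕ.<_) (+-suc L v) k<end)
... | inj₁ k<L+v = inj₁ (L≤k , k<L+v)
... | inj₂ k≡L+v = inj₂ k≡L+v

extend-right⁻¹ : ∀ {L v k} → InBlock L v k ⊎ k ≡ L ℕ.+ v → InBlock L (suc v) k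
extend-right⁻¹ {L} {v} {k} (inj₁ (L≤k , k<L+v)) =
  L≤k , subst (k ℕ.<_) (sym (+-suc L v)) (ℕP.m<n⇒m<1+n k<L+v)
extend-right⁻¹ {L} {v} (inj₂ refl) = m≤m+n L v , +-monoʳ-< L (n<1+n v)

module Blocks {n : ℕ} {f : ℕ → ℕ} (V : Valley n f) where
  open Valley V

  record Block (v L : ℕ) : Set where
    field
      within : ∀ {k} → InBlock L v k → Pos n k
      inside : ∀ {k} → Pos n k → f k ℕ.≤ v → InBlock L v k
      covers : ∀ {k} → Pos n k → InBlock L v k → f k ℕ.≤ v

  empty-block : ∀ L → Block 0 L
  empty-block L = record
    { within = λ k∈ → ⊥-elim (not-in-empty k∈)
    ; inside = λ pk fk≤0 → ⊥-elim (<⇒≱ (positive pk) fk≤0)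
    ; covers = λ _ k∈ → ⊥-elim (not-in-empty k∈)
    }

  squeeze : ∀ {v L a k c} → Block v L → Pos n a → Pos n c → a ℕ.< k → k ℕ.< c →
            f a ℕ.≤ suc v → f c ℕ.≤ suc v → InBlock L v k
  squeeze {v} {k = k} B pa pc a<k k<c fa fc = Block.inside B pk (≤-pred fk<)
    where
    pk : Pos n k
    pk = ≤-trans (proj₁ pa) (<⇒≤ a<k) , ≤-trans (<⇒≤ k<c) (proj₂ pc)
    fk< : f k ℕ.< suc v
    fk< with dip pa pc a<k k<c
    ... | inj₁ below-a = <-≤-trans below-a fa
    ... | inj₂ below-c = <-≤-trans below-c fc

  adjacent : ∀ {v L q} → Block v L → 1 ℕ.≤ v → Pos n q → f q ≡ suc v →
             suc q ≡ L ⊎ q ≡ L ℕ.+ v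
  adjacent {suc u} {L} {q} B _ pq fq with q <? L
  ... | yes q<L = inj₁ (≤-antisym q<L (≮⇒≥ gap))
    where
    L∈ : InBlock L (suc u) L
    L∈ = ≤-refl , m<m+n L (s≤s z≤n)
    pL : Pos n L
    pL = Block.within B L∈
    gap : suc q ℕ.< L → ⊥
    gap sq<L = <⇒≱ sq<L (proj₁ (squeeze B pq pL (n<1+n q) sq<L
                 (≤-reflexive fq) (m≤n⇒m≤1+n (Block.covers B pL L∈))))
  ... | no q≮L = inj₂ (≤-antisym (≮⇒≥ gap) end≤q)
    where
    end≤q : L ℕ.+ suc u ℕ.≤ q
    end≤q = ≮⇒≥ λ q<end → <-irrefl refl
              (≤-<-trans (≤-reflexive (sym fq)) (s≤s (Block.covers B pq (≮⇒≥ q≮L , q<end))))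
    last∈ : InBlock L (suc u) (L ℕ.+ u)
    last∈ = m≤m+n L u , +-monoʳ-< L (n<1+n u)
    gap : L ℕ.+ suc u ℕ.< q → ⊥
    gap end<q = <-irrefl refl (proj₂ (squeeze B plast pq (+-monoʳ-< L (n<1+n u)) end<q
                  (m≤n⇒m≤1+n (Block.covers B plast last∈)) (≤-reflexive fq)))
      where
      plast : Pos n (L ℕ.+ u)
      plast = Block.within B last∈

  grow : ∀ {v L L' q} → Block v L → Pos n q → f q ≡ suc v →
         (∀ {k} → InBlock L' (suc v) k → InBlock L v k ⊎ k ≡ q) →
         (∀ {k} → InBlock L v k ⊎ k ≡ q → InBlock L' (suc v) k) →
         Block (suc v) L'
  grow {v} {q = q} B pq fq split merge = record
    { within = λ k∈ → old-or-new (split k∈)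
    ; inside = inside'
    ; covers = λ pk k∈ → covers' pk (split k∈)
    }
    where
    old-or-new : ∀ {k} → InBlock _ v k ⊎ k ≡ q → Pos n k
    old-or-new (inj₁ k∈) = Block.within B k∈
    old-or-new (inj₂ refl) = pq
    inside' : ∀ {k} → Pos n k → f k ℕ.≤ suc v → InBlock _ (suc v) k
    inside' pk fk with m≤n⇒m<n∨m≡n fk
    ... | inj₁ fk≤v = merge (inj₁ (Block.inside B pk (≤-pred fk≤v)))
    ... | inj₂ fk≡ = merge (inj₂ (injective pk pq (trans fk≡ (sym fq))))
    covers' : ∀ {k} → Pos n k → InBlock _ v k ⊎ k ≡ q → f k ℕ.≤ suc v
    covers' pk (inj₁ k∈) = m≤n⇒m≤1+n (Block.covers B pk k∈)
    covers' pk (inj₂ refl) = ≤-reflexive fq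

  block-of : ∀ v → v ℕ.≤ n → Σ ℕ (Block v)
  block-of zero _ = 1 , empty-block 1
  block-of (suc zero) 1≤n with surjective (≤-refl , 1≤n)
  ... | q , pq , fq = q , grow (empty-block q) pq fq
          (λ k∈ → Data.Sum.map₂ (λ e → trans e (+-identityʳ q)) (extend-right k∈))
          (λ k∈ → extend-right⁻¹ (Data.Sum.map₂ (λ e → trans e (sym (+-identityʳ q))) k∈))
  block-of (suc (suc u)) le with block-of (suc u) (<⇒≤ le) | surjective (s≤s z≤n , le)
  ... | L , B | q , pq , fq with adjacent B (s≤s z≤n) pq fq
  ... | inj₁ refl = q , grow B pq fq extend-left extend-left⁻¹
  ... | inj₂ refl = L , grow B pq fq extend-right extend-right⁻¹

-- Ascending signed permutations: k ↦ |w(k)| is a valley permutation of [n].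

module AscendingSigned {n : ℕ} {w : ℤ → ℤ} (B : InB n w) (A : Ascending n w) where
  open InB B

  absw : ℕ → ℕ
  absw k = ∣ w (+ k) ∣

  in-range : ∀ {k} → k ℕ.≤ n → InRange n (+ k)
  in-range {k} k≤n = neg≤pos n k , +≤+ k≤n

  w0 : w (+ 0) ≡ + 0
  w0 = self-negative (w (+ 0)) (odd-sym (+ 0) (in-range z≤n))

  -- Since 0 ↦ 0 and ±k ↦ ±w(k), the absolute values form a permutation of [n].
  absw-positive : ∀ {k} → Pos n k → 1 ℕ.≤ absw k
  absw-positive {suc k} (_ , k≤n) with absw (suc k) in eq
  ... | suc _ = s≤s z≤n
  ... | zero with injective (+ suc k) (+ 0) (in-range k≤n) (in-range z≤n)
                    (trans (ℤP.∣i∣≡0⇒i≡0 eq) (sym w0))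
  ... | ()

  absw-injective : ∀ {k l} → Pos n k → Pos n l → absw k ≡ absw l → k ≡ l
  absw-injective {k} {suc l} (_ , k≤n) (_ , l≤n) e with abs-cancel _ _ e
  ... | inj₁ same = ℤP.+-injective (injective _ _ (in-range k≤n) (in-range l≤n) same)
  ... | inj₂ opposite
        with injective (+ k) -[1+ l ] (in-range k≤n) (neg-in-range l≤n)
               (trans opposite (sym (odd-sym (+ suc l) (in-range l≤n))))
  ... | ()

  absw-surjective : ∀ {v} → Pos n v → Σ ℕ λ k → Pos n k × absw k ≡ v
  absw-surjective {suc v} (_ , v≤n) with surjective (+ suc v) (in-range v≤n)
  ... | + zero , _ , e with trans (sym w0) e
  ...   | ()
  absw-surjective {suc v} _ | + suc k , (_ , +≤+ k≤n) , e =
    suc k , (s≤s z≤n , k≤n) , cong ∣_∣ e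
  absw-surjective {suc v} _ | -[1+ k ] , r , e =
    suc k , (s≤s z≤n , abs-in-range _ r) ,
    cong ∣_∣ (trans (odd-sym _ r) (cong ℤ.-_ e))

  ascending : ∀ {k l} → 1 ℕ.≤ k → k ℕ.< l → l ℕ.≤ n → w (+ k) < w (+ l)
  ascending {k} {suc l} 1≤k k<sl sl≤n with m<1+n⇒m<n∨m≡n k<sl
  ... | inj₁ k<l = ℤP.<-trans (ascending 1≤k k<l (≤-trans (n≤1+n l) sl≤n))
                              (A l (≤-trans 1≤k (<⇒≤ k<l)) sl≤n)
  ... | inj₂ refl = A k 1≤k sl≤n

  -- Negative values of w come first (|w| decreasing), positive ones last
  -- (|w| increasing); hence no interior maximum of |w|.
  absw-dip : ∀ {q k r} → Pos n q → Pos n r → q ℕ.< k → k ℕ.< r →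
             absw k ℕ.< absw q ⊎ absw k ℕ.< absw r
  absw-dip {q} {k} {r} (1≤q , _) (_ , r≤n) q<k k<r
    with sign-of-nonzero (w (+ k)) (absw-positive pk)
    where
    pk : Pos n k
    pk = ≤-trans 1≤q (<⇒≤ q<k) , ≤-trans (<⇒≤ k<r) r≤n
  ... | inj₁ negative = inj₁ (abs-antitone-neg (ascending 1≤q q<k (≤-trans (<⇒≤ k<r) r≤n)) negative)
  ... | inj₂ positive = inj₂ (abs-monotone-pos positive (ascending (≤-trans 1≤q (<⇒≤ q<k)) k<r r≤n))

  ascending-≤ : ∀ {k l} → 1 ℕ.≤ k → k ℕ.≤ l → l ℕ.≤ n → w (+ k) ℤ.≤ w (+ l)
  ascending-≤ 1≤k k≤l l≤n with m≤n⇒m<n∨m≡n k≤l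
  ... | inj₁ k<l = ℤP.<⇒≤ (ascending 1≤k k<l l≤n)
  ... | inj₂ refl = ℤP.≤-refl

  nothing-between : ∀ {k p} → Pos n k → Pos n p → Pos n (suc p) →
                    w (+ p) < w (+ k) → w (+ k) < w (+ suc p) → ⊥
  nothing-between {k} {p} (1≤k , k≤n) (_ , p≤n) (1≤sp , _) above below with k ℕP.≤? p
  ... | yes k≤p = ℤP.<⇒≱ above (ascending-≤ 1≤k k≤p p≤n)
  ... | no k≰p = ℤP.<⇒≱ below (ascending-≤ 1≤sp (ℕP.≰⇒> k≰p) k≤n)

  valley : Valley n absw
  valley = record
    { positive   = absw-positive
    ; bounded    = λ { (_ , k≤n) → abs-in-range _ (maps-into _ (in-range k≤n)) }
    ; injective  = absw-injective
    ; surjective = absw-surjective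
    ; dip        = absw-dip
    }

PairFacts : ℕ → (ℤ → ℤ) → ℕ → ℕ → Set
PairFacts n w a b =
  OddZ (+ ∣ w (+ b) ∣ - + ∣ w (+ a) ∣)
  × ((+ 0 < w (+ b) →
       (+ 0 < + ∣ w (+ b) ∣ - + ∣ w (+ a) ∣)
       × (∀ (e : ℕ) → ∣ w (+ a) ∣ ℕ.< e → e ℕ.< ∣ w (+ b) ∣ →
            ∀ (k : ℤ) → InRange n k → w k ≡ + e → k < + 0)
       × (∣ w (+ a) ∣ ≢ 1 → + 0 < w (+ a)))
    × (w (+ b) < + 0 → + ∣ w (+ a) ∣ - + ∣ w (+ b) ∣ ≡ + 1))

module ChessboardPair {n : ℕ} {w : ℤ → ℤ} (B : InB n w) (E : EvenChessboard n w)
                      (A : Ascending n w) {p : ℕ} (psp : Pos n (suc p)) (sp-even : suc p % 2 ≡ 0)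
                      where
  open AscendingSigned B A
  open Valley valley
  open Blocks valley

  p-odd : p % 2 ≡ 1
  p-odd = %-pred-≡0 {m = p} sp-even

  pp : Pos n p
  pp = odd⇒positive p p-odd , <⇒≤ (proj₂ psp)

  chessboard : ∀ {k} → Pos n k → absw k % 2 ≡ k % 2
  chessboard (1≤k , k≤n) = E _ 1≤k k≤n

  absw-p-odd : absw p % 2 ≡ 1
  absw-p-odd = trans (chessboard pp) p-odd

  absw-sp-even : absw (suc p) % 2 ≡ 0
  absw-sp-even = trans (chessboard psp) sp-even

  step-up : w (+ p) < w (+ suc p)
  step-up = ascending (proj₁ pp) (n<1+n p) (proj₂ psp)

  -- The value 1 sits at the sign change of w; parity puts it at p, not p+1.
  one-at-sign-change : w (+ p) < + 0 → + 0 < w (+ suc p) → absw p ≡ 1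
  one-at-sign-change negative positive′ with surjective (≤-refl , ≤-trans (proj₁ pp) (proj₂ pp))
  ... | q , pq , fq with <-cmp q p
  ... | tri< q<p _ _ = ⊥-elim (<⇒≱ (subst (absw p ℕ.<_) fq
          (abs-antitone-neg (ascending (proj₁ pq) q<p (proj₂ pp)) negative)) (positive pp))
  ... | tri≈ _ refl _ = fq
  ... | tri> _ _ p<q with m≤n⇒m<n∨m≡n p<q
  ...   | inj₁ sp<q = ⊥-elim (<⇒≱ (subst (absw (suc p) ℕ.<_) fq
            (abs-monotone-pos positive′ (ascending (proj₁ psp) sp<q (proj₂ pq)))) (positive psp))
  ...   | inj₂ refl with trans (sym (cong (_% 2) fq)) absw-sp-even
  ...     | ()

  ascent-if-positive : + 0 < w (+ suc p) → absw p ℕ.< absw (suc p)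
  ascent-if-positive positive′ with sign-of-nonzero (w (+ p)) (positive pp)
  ... | inj₂ p-positive = abs-monotone-pos p-positive step-up
  ... | inj₁ p-negative = subst (ℕ._< absw (suc p)) (sym one) (ℕP.≤∧≢⇒< (positive psp) one≢)
    where
    one : absw p ≡ 1
    one = one-at-sign-change p-negative positive′
    one≢ : 1 ≢ absw (suc p)
    one≢ e = <-irrefl (sym (injective psp pp (trans (sym e) (sym one)))) (n<1+n p)

  between-if-positive : + 0 < w (+ suc p) → ∀ e → absw p ℕ.< e → e ℕ.< absw (suc p) →
                        ∀ k → InRange n k → w k ≡ + e → k < + 0
  between-if-positive _ _ _ _ -[1+ _ ] _ _ = -<+
  between-if-positive _ _ lo _ (+ zero) _ wk≡e =
    ⊥-elim (ℕP.n≮0 (subst (absw p ℕ.<_) (ℤP.+-injective (trans (sym wk≡e) w0)) lo))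
  between-if-positive positive′ _ lo hi (+ suc k) (_ , +≤+ k≤n) wk≡e =
    ⊥-elim (nothing-between (s≤s z≤n , k≤n) pp psp
      (subst (w (+ p) <_) (sym wk≡e) (below-of-abs (w (+ p)) lo))
      (subst (_< w (+ suc p)) (sym wk≡e) (above-of-abs positive′ hi)))

  sign-if-positive : + 0 < w (+ suc p) → absw p ≢ 1 → + 0 < w (+ p)
  sign-if-positive positive′ ≢1 with sign-of-nonzero (w (+ p)) (positive pp)
  ... | inj₂ p-positive = p-positive
  ... | inj₁ p-negative = ⊥-elim (≢1 (one-at-sign-change p-negative positive′))

  -- (2) If w(p+1) < 0 then |w(p)| = |w(p+1)| + 1.  Write c = |w(p+1)| < |w(p)|.
  descent-order : w (+ suc p) < + 0 → absw (suc p) ℕ.< absw p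
  descent-order negative = abs-antitone-neg step-up negative

  -- The block of the values 1,…,c contains p+1 but not p, so it starts at p+1.
  block-start : ∀ {L} → Block (absw (suc p)) L → absw (suc p) ℕ.< absw p → L ≡ suc p
  block-start {L} block c<d = ≤-antisym (proj₁ sp∈) (≮⇒≥ λ L<sp → <⇒≱ c<d
      (Block.covers block pp (≤-pred L<sp , <-trans (n<1+n p) (proj₂ sp∈))))
    where
    sp∈ : InBlock L (absw (suc p)) (suc p)
    sp∈ = Block.inside block psp ≤-refl

  -- The odd value c+1 cannot sit at the even position p+1+c.
  parity-clash : ∀ {q} → Pos n q → absw q ≡ suc (absw (suc p)) → q ≢ suc p ℕ.+ absw (suc p)
  parity-clash pq fq refl with
    trans (sym (trans (cong (_% 2) fq) (suc-even (absw (suc p)) absw-sp-even)))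
          (trans (chessboard pq) (even+even (suc p) (absw (suc p)) sp-even absw-sp-even))
  ... | ()

  -- So c+1, which lies next to that block, sits at p.
  descent-if-negative : w (+ suc p) < + 0 → absw p ≡ suc (absw (suc p))
  descent-if-negative negative
    with block-of (absw (suc p)) (bounded psp)
       | surjective (s≤s z≤n , ≤-trans (descent-order negative) (bounded pp))
  ... | L , block | q , pq , fq
    with block-start block (descent-order negative) | adjacent block (positive psp) pq fq
  ... | refl | inj₁ refl = fq
  ... | refl | inj₂ q≡ = ⊥-elim (parity-clash pq fq q≡)

  pair-facts : PairFacts n w p (suc p)
  pair-facts =
      even-minus-odd (absw (suc p)) (absw p) absw-sp-even absw-p-odd
    , (λ positive′ → positive-difference (ascent-if-positive positive′)
                   , between-if-positive positive′
                   , sign-if-positive positive′)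
    , λ negative → trans (cong (λ d → + d - + absw (suc p)) (descent-if-negative negative))
                         (successor-difference (absw (suc p)))

-- The theorem: apply the pair analysis to the even position 2j ∈ [n].  Once
-- j is a successor, 2j reduces to a successor, so 2j = suc (2j - 1) holds
-- definitionally and no transport is needed.
lemma3p2 : (n : ℕ) (w : ℤ → ℤ) → InC0 n w → Ascending n w →
    (j : ℕ) → 1 ℕ.≤ j → j ℕ.≤ n / 2 →
    OddZ (+ ∣ w (+ (2 ℕ.* j)) ∣ - + ∣ w (+ (2 ℕ.* j ℕ.∸ 1)) ∣)
    × ((+ 0 < w (+ (2 ℕ.* j)) →
         (+ 0 < + ∣ w (+ (2 ℕ.* j)) ∣ - + ∣ w (+ (2 ℕ.* j ℕ.∸ 1)) ∣)
         × (∀ (e : ℕ) → ∣ w (+ (2 ℕ.* j ℕ.∸ 1)) ∣ ℕ.< e → e ℕ.< ∣ w (+ (2 ℕ.* j)) ∣ →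
              ∀ (k : ℤ) → InRange n k → w k ≡ + e → k < + 0)
         × (∣ w (+ (2 ℕ.* j ℕ.∸ 1)) ∣ ≢ 1 → + 0 < w (+ (2 ℕ.* j ℕ.∸ 1))))
      × (w (+ (2 ℕ.* j)) < + 0 →
         + ∣ w (+ (2 ℕ.* j ℕ.∸ 1)) ∣ - + ∣ w (+ (2 ℕ.* j)) ∣ ≡ + 1))
lemma3p2 n w (B , E) A j@(suc _) _ j≤n/2 = ChessboardPair.pair-facts B E A 2j∈[n] 2j-even
  where
  2j∈[n] : Pos n (2 ℕ.* j)
  2j∈[n] = s≤s z≤n , ≤-trans (ℕP.*-monoʳ-≤ 2 j≤n/2)
                              (subst (ℕ._≤ n) (ℕP.*-comm (n / 2) 2) (m/n*n≤m n 2))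
  2j-even : (2 ℕ.* j) % 2 ≡ 0
  2j-even = trans (cong (_% 2) (ℕP.*-comm 2 j)) (m*n%n≡0 j 2)
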